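{- Let $n_1,n_2,n_3\ge 2$ and let $u=(x_1,x_2,0)$ and $v=(y_1,y_2,n_3-1)$ be two vertices of $P_{n_1}\Box P_{n_2}\Box P_{n_3}$. Then there are at least $n_3(n_1+n_2-2)$ vertices in $F(n_1,n_2,n_3)$ resolving $u$ and $v$.
   Context: $P_{n_1}\Box P_{n_2}\Box P_{n_3}$ is the grid graph with vertex set $\{(x_1,x_2,x_3): 0\le x_i\le n_i-1\}$, two vertices adjacent iff they differ by exactly $1$ in exactly one coordinate; $d(x,y)=\sum_i|x_i-y_i|$. A vertex $w$ resolves $u,v$ if $d(w,u)\ne d(w,v)$. $F(n_1,n_2,n_3)=\{(x_1,x_2,x_3): x_i\in\{0,n_i-1\}\text{ for some }i\}$. -}

module Defs where

open import Data.Nat using (ℕ; _+_; ∣_-_∣; _≟_)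
open import Data.Fin using (Fin; toℕ)
import Data.Fin as Fin
open import Data.Product using (_×_; _,_)
open import Data.Sum using (_⊎_)
open import Data.List using (List; allFin; cartesianProduct; filter; length)
open import Relation.Binary.PropositionalEquality using (_≡_)
open import Relation.Nullary using (¬_; Dec; yes; no)
open import Relation.Nullary.Decidable using (_⊎-dec_; ¬?)

Vertex : ℕ → ℕ → ℕ → Set
Vertex n₁ n₂ n₃ = Fin n₁ × Fin n₂ × Fin n₃

dist : ∀ {n₁ n₂ n₃} → Vertex n₁ n₂ n₃ → Vertex n₁ n₂ n₃ → ℕ
dist (a₁ , a₂ , a₃) (b₁ , b₂ , b₃) =
  ∣ toℕ a₁ - toℕ b₁ ∣ + ∣ toℕ a₂ - toℕ b₂ ∣ + ∣ toℕ a₃ - toℕ b₃ ∣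

Resolves : ∀ {n₁ n₂ n₃} → Vertex n₁ n₂ n₃ → Vertex n₁ n₂ n₃ → Vertex n₁ n₂ n₃ → Set
Resolves w u v = ¬ (dist w u ≡ dist w v)

resolves? : ∀ {n₁ n₂ n₃} (w u v : Vertex n₁ n₂ n₃) → Dec (Resolves w u v)
resolves? w u v = ¬? (dist w u ≟ dist w v)

Extreme : (n : ℕ) → Fin n → Set
Extreme n x = (toℕ x ≡ 0) ⊎ (toℕ x + 1 ≡ n)

extreme? : (n : ℕ) (x : Fin n) → Dec (Extreme n x)
extreme? n x = (toℕ x ≟ 0) ⊎-dec (toℕ x + 1 ≟ n)

InF : ∀ {n₁ n₂ n₃} → Vertex n₁ n₂ n₃ → Set
InF {n₁} {n₂} {n₃} (x₁ , x₂ , x₃) = Extreme n₁ x₁ ⊎ Extreme n₂ x₂ ⊎ Extreme n₃ x₃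

inF? : ∀ {n₁ n₂ n₃} (w : Vertex n₁ n₂ n₃) → Dec (InF w)
inF? {n₁} {n₂} {n₃} (x₁ , x₂ , x₃) =
  extreme? n₁ x₁ ⊎-dec (extreme? n₂ x₂ ⊎-dec extreme? n₃ x₃)

vertices : (n₁ n₂ n₃ : ℕ) → List (Vertex n₁ n₂ n₃)
vertices n₁ n₂ n₃ = cartesianProduct (allFin n₁) (cartesianProduct (allFin n₂) (allFin n₃))

resolvingInF : ∀ {n₁ n₂ n₃} → Vertex n₁ n₂ n₃ → Vertex n₁ n₂ n₃ → ℕ
resolvingInF {n₁} {n₂} {n₃} u v =
  length (filter (λ w → inF? w) (filter (λ w → resolves? w u v) (vertices n₁ n₂ n₃)))

-- For a vertex w = (i, j, k) the two distances are d(w,u) = p + k and d(w,v) = q + (n₃ - 1 - k),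
-- with p, q depending only on the column (i, j). The first grows and the second shrinks with k,
-- so each column contains at most one vertex not resolving u and v. Every column over the
-- boundary of the n₁ × n₂ rectangle lies in F, and there are 2(n₁ + n₂ - 2) of them, giving at
-- least 2(n₁ + n₂ - 2)(n₃ - 1) ≥ n₃(n₁ + n₂ - 2) resolving vertices in F.
module Submission where

open import Defs
open import Data.Nat using (ℕ; zero; suc; _+_; _*_; _∸_; _≤_; _<_; z≤n; s≤s; s≤s⁻¹; ∣_-_∣; _≟_)
open import Data.Nat.Properties
open import Data.Nat.Solver using (module +-*-Solver)
open import Data.Fin using (Fin; toℕ; fromℕ)
import Data.Fin as Fin
open import Data.Fin.Properties using (toℕ-fromℕ; toℕ-injective; toℕ<n)
import Data.Fin.Properties as Fin
open import Data.Product using (_×_; _,_)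
open import Data.Sum using (_⊎_; inj₁; inj₂; [_,_])
open import Data.Bool using (true; false)
open import Data.List using (List; []; _∷_; _++_; map; filter; length; tabulate; allFin; cartesianProduct)
open import Data.Nat.ListAction using (sum)
open import Data.List.Properties using (length-++; filter-++; filter-all; length-tabulate; map-tabulate; map-cong)
open import Data.List.Relation.Unary.All.Properties using (tabulate⁺)
open import Function using (_∘_; id)
open import Level using (Level)
open import Relation.Binary.PropositionalEquality using (_≡_; refl; sym; trans; cong; cong₂; subst; module ≡-Reasoning)
open import Relation.Nullary using (¬_; Dec; does; yes; no)
open import Relation.Nullary.Decidable using (decidable-stable)
open import Relation.Unary using (Pred; Decidable)
open import Relation.Unary.Properties using (_∩?_)

private
  variable
    α β γ ℓ ℓ′ : Level
    A : Set α
    B : Set β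
    C : Set γ

filter-filter : {P : Pred A ℓ} {Q : Pred A ℓ′} (P? : Decidable P) (Q? : Decidable Q) (xs : List A) →
  filter Q? (filter P? xs) ≡ filter (P? ∩? Q?) xs
filter-filter P? Q? [] = refl
filter-filter P? Q? (x ∷ xs) with does (P? x)
... | false = filter-filter P? Q? xs
... | true with does (Q? x)
...   | false = filter-filter P? Q? xs
...   | true  = cong (x ∷_) (filter-filter P? Q? xs)

length-filter-map : {P : Pred C ℓ} (P? : Decidable P) (f : B → C) (xs : List B) →
  length (filter P? (map f xs)) ≡ length (filter (P? ∘ f) xs)
length-filter-map P? f [] = refl
length-filter-map P? f (x ∷ xs) with does (P? (f x))
... | false = length-filter-map P? f xs
... | true  = cong suc (length-filter-map P? f xs)

length-filter-cartesianProduct : {P : Pred (A × B) ℓ} (P? : Decidable P) (xs : List A) (ys : List B) →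
  length (filter P? (cartesianProduct xs ys)) ≡
  sum (map (λ x → length (filter (λ y → P? (x , y)) ys)) xs)
length-filter-cartesianProduct P? [] ys = refl
length-filter-cartesianProduct P? (x ∷ xs) ys = begin
  length (filter P? (map (x ,_) ys ++ cartesianProduct xs ys))
    ≡⟨ cong length (filter-++ P? (map (x ,_) ys) _) ⟩
  length (filter P? (map (x ,_) ys) ++ filter P? (cartesianProduct xs ys))
    ≡⟨ length-++ (filter P? (map (x ,_) ys)) ⟩
  length (filter P? (map (x ,_) ys)) + length (filter P? (cartesianProduct xs ys))
    ≡⟨ cong₂ _+_ (length-filter-map P? (x ,_) ys) (length-filter-cartesianProduct P? xs ys) ⟩
  length (filter (λ y → P? (x , y)) ys) + sum (map (λ x → length (filter (λ y → P? (x , y)) ys)) xs) ∎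
  where open ≡-Reasoning

n∸1≤length-filter-tabulate : ∀ {n} {P : Pred A ℓ} (P? : Decidable P) (f : Fin n → A) →
  (∀ i j → ¬ P (f i) → ¬ P (f j) → i ≡ j) → n ∸ 1 ≤ length (filter P? (tabulate f))
n∸1≤length-filter-tabulate {n = zero} P? f failsOnce = z≤n
n∸1≤length-filter-tabulate {n = suc n} {P = P} P? f failsOnce with P? (f Fin.zero)
... | yes _ = ≤-trans (m≤n+m∸n n 1)
                (s≤s (n∸1≤length-filter-tabulate P? (f ∘ Fin.suc) (λ i j ¬Pi ¬Pj →
                   Fin.suc-injective (failsOnce (Fin.suc i) (Fin.suc j) ¬Pi ¬Pj))))
... | no ¬P₀ = ≤-reflexive (sym (begin
  length (filter P? (tabulate (f ∘ Fin.suc))) ≡⟨ cong length (filter-all P? (tabulate⁺ rest)) ⟩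
  length (tabulate (f ∘ Fin.suc))             ≡⟨ length-tabulate (f ∘ Fin.suc) ⟩
  n                                           ∎))
  where
  open ≡-Reasoning
  rest : ∀ i → P (f (Fin.suc i))
  rest i = decidable-stable (P? (f (Fin.suc i))) (λ ¬Pi → Fin.0≢1+n (failsOnce Fin.zero (Fin.suc i) ¬P₀ ¬Pi))

sum-tabulate-≥-last : ∀ {m b} (f : Fin (suc m) → ℕ) → (∀ i → b ≤ f i) →
  m * b + f (fromℕ m) ≤ sum (tabulate f)
sum-tabulate-≥-last {zero} f _ = ≤-reflexive (sym (+-identityʳ (f Fin.zero)))
sum-tabulate-≥-last {suc m} {b} f b≤f = begin
  b + m * b + f (fromℕ (suc m))   ≡⟨ +-assoc b (m * b) _ ⟩
  b + (m * b + f (fromℕ (suc m))) ≤⟨ +-mono-≤ (b≤f Fin.zero) (sum-tabulate-≥-last (f ∘ Fin.suc) (b≤f ∘ Fin.suc)) ⟩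
  sum (tabulate f)                ∎
  where open ≤-Reasoning

sum-allFin-≥-ends : ∀ {m a b} (f : Fin (suc (suc m)) → ℕ) →
  (∀ i → Extreme (suc (suc m)) i → a ≤ f i) → (∀ i → b ≤ f i) →
  a + (m * b + a) ≤ sum (map f (allFin (suc (suc m))))
sum-allFin-≥-ends {m} {a} {b} f a≤ends b≤f = begin
  a + (m * b + a)                     ≤⟨ +-mono-≤ (a≤ends Fin.zero (inj₁ refl)) (+-monoʳ-≤ (m * b) (a≤ends last lastExtreme)) ⟩
  f Fin.zero + (m * b + f last)       ≤⟨ +-monoʳ-≤ (f Fin.zero) (sum-tabulate-≥-last (f ∘ Fin.suc) (b≤f ∘ Fin.suc)) ⟩
  sum (tabulate f)                    ≡⟨ cong sum (sym (map-tabulate id f)) ⟩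
  sum (map f (allFin (suc (suc m)))) ∎
  where
  open ≤-Reasoning
  last : Fin (suc (suc m))
  last = fromℕ (suc m)
  lastExtreme : Extreme (suc (suc m)) last
  lastExtreme = inj₂ (trans (cong (_+ 1) (toℕ-fromℕ (suc m))) (+-comm (suc m) 1))

+-≡-+∸⇒≮ : ∀ {p q c k k′} → p + k ≡ q + (c ∸ k) → p + k′ ≡ q + (c ∸ k′) → ¬ k < k′
+-≡-+∸⇒≮ {p} {q} {c} {k} {k′} e e′ k<k′ = <-irrefl refl (begin-strict
  p + k         <⟨ +-monoʳ-< p k<k′ ⟩
  p + k′        ≡⟨ e′ ⟩
  q + (c ∸ k′)  ≤⟨ +-monoʳ-≤ q (∸-monoʳ-≤ c (<⇒≤ k<k′)) ⟩
  q + (c ∸ k)   ≡⟨ sym e ⟩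
  p + k         ∎)
  where open ≤-Reasoning

+-≡-+∸-unique : ∀ {p q c k k′} → p + k ≡ q + (c ∸ k) → p + k′ ≡ q + (c ∸ k′) → k ≡ k′
+-≡-+∸-unique e e′ = ≤-antisym (≮⇒≥ (+-≡-+∸⇒≮ e′ e)) (≮⇒≥ (+-≡-+∸⇒≮ e e′))

module Columns {n₁ n₂ n₃} {x₁ y₁ : Fin n₁} {x₂ y₂ : Fin n₂} {z₀ z₁ : Fin n₃}
               (bottom : toℕ z₀ ≡ 0) (top : suc (toℕ z₁) ≡ n₃) where

  u v : Vertex n₁ n₂ n₃
  u = x₁ , x₂ , z₀
  v = y₁ , y₂ , z₁

  equidistant-unique-in-column : ∀ i j {k k′} →
    dist (i , j , k) u ≡ dist (i , j , k) v → dist (i , j , k′) u ≡ dist (i , j , k′) v → k ≡ k′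
  equidistant-unique-in-column i j {k} {k′} e e′ =
    toℕ-injective (+-≡-+∸-unique (levels k e) (levels k′ e′))
    where
    p q : ℕ
    p = ∣ toℕ i - toℕ x₁ ∣ + ∣ toℕ j - toℕ x₂ ∣
    q = ∣ toℕ i - toℕ y₁ ∣ + ∣ toℕ j - toℕ y₂ ∣
    levels : ∀ k → dist (i , j , k) u ≡ dist (i , j , k) v → p + toℕ k ≡ q + (toℕ z₁ ∸ toℕ k)
    levels k e = begin
      p + toℕ k                  ≡⟨ cong (p +_) (sym (∣-∣-identityʳ (toℕ k))) ⟩
      p + ∣ toℕ k - 0 ∣           ≡⟨ cong (λ z → p + ∣ toℕ k - z ∣) (sym bottom) ⟩
      p + ∣ toℕ k - toℕ z₀ ∣      ≡⟨ e ⟩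
      q + ∣ toℕ k - toℕ z₁ ∣      ≡⟨ cong (q +_) (m≤n⇒∣m-n∣≡n∸m (s≤s⁻¹ (subst (toℕ k <_) (sym top) (toℕ<n k)))) ⟩
      q + (toℕ z₁ ∸ toℕ k)       ∎
      where open ≡-Reasoning

  ResolvesInF : Vertex n₁ n₂ n₃ → Set
  ResolvesInF w = Resolves w u v × InF w

  resolvesInF? : ∀ w → Dec (ResolvesInF w)
  resolvesInF? = (λ w → resolves? w u v) ∩? inF?

  column : Fin n₁ → Fin n₂ → ℕ
  column i j = length (filter (λ k → resolvesInF? (i , j , k)) (allFin n₃))

  resolvingInF≡sum-columns : resolvingInF u v ≡ sum (map (λ i → sum (map (column i) (allFin n₂))) (allFin n₁))
  resolvingInF≡sum-columns = begin
    resolvingInF u v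
      ≡⟨ cong length (filter-filter (λ w → resolves? w u v) inF? (vertices n₁ n₂ n₃)) ⟩
    length (filter resolvesInF? (vertices n₁ n₂ n₃))
      ≡⟨ length-filter-cartesianProduct resolvesInF? (allFin n₁) _ ⟩
    sum (map (λ i → length (filter (λ jk → resolvesInF? (i , jk)) (cartesianProduct (allFin n₂) (allFin n₃)))) (allFin n₁))
      ≡⟨ cong sum (map-cong (λ i → length-filter-cartesianProduct (λ jk → resolvesInF? (i , jk)) (allFin n₂) (allFin n₃)) (allFin n₁)) ⟩
    sum (map (λ i → sum (map (column i) (allFin n₂))) (allFin n₁)) ∎
    where open ≡-Reasoning

  boundary-column-≥ : ∀ i j → Extreme n₁ i ⊎ Extreme n₂ j → n₃ ∸ 1 ≤ column i j
  boundary-column-≥ i j boundary =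
    n∸1≤length-filter-tabulate (λ k → resolvesInF? (i , j , k)) id failsOnce
    where
    inF : ∀ k → InF (i , j , k)
    inF k = [ inj₁ , inj₂ ∘ inj₁ ] boundary
    equidistant : ∀ k → ¬ ResolvesInF (i , j , k) → dist (i , j , k) u ≡ dist (i , j , k) v
    equidistant k fails = decidable-stable (dist (i , j , k) u ≟ dist (i , j , k) v) (λ r → fails (r , inF k))
    failsOnce : ∀ k k′ → ¬ ResolvesInF (i , j , k) → ¬ ResolvesInF (i , j , k′) → k ≡ k′
    failsOnce k k′ fails fails′ = equidistant-unique-in-column i j (equidistant k fails) (equidistant k′ fails′)

-- The right side counts 2(m₁ + m₂ + 2) boundary columns of c each, and n₃ = 1 + c ≤ 2c.
boundary-count-bound : ∀ m₁ m₂ m₃ → let c = suc m₃ in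
  suc c * (m₁ + suc (suc m₂)) ≤ c + (m₂ * c + c) + (m₁ * (c + (m₂ * 0 + c)) + (c + (m₂ * c + c)))
boundary-count-bound m₁ m₂ m₃ = begin
  suc c * (m₁ + suc (suc m₂))   ≤⟨ *-monoˡ-≤ (m₁ + suc (suc m₂)) (s≤s (m≤n+m c m₃)) ⟩
  (c + c) * (m₁ + suc (suc m₂)) ≡⟨ expand m₁ m₂ c ⟩
  c + (m₂ * c + c) + (m₁ * (c + (m₂ * 0 + c)) + (c + (m₂ * c + c))) ∎
  where
  open ≤-Reasoning
  open +-*-Solver
  c : ℕ
  c = suc m₃
  expand : ∀ m₁ m₂ c → (c + c) * (m₁ + suc (suc m₂)) ≡ c + (m₂ * c + c) + (m₁ * (c + (m₂ * 0 + c)) + (c + (m₂ * c + c)))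
  expand = solve 3 (λ m₁ m₂ c → (c :+ c) :* (m₁ :+ (con 2 :+ m₂)) := c :+ (m₂ :* c :+ c) :+ (m₁ :* (c :+ (m₂ :* con 0 :+ c)) :+ (c :+ (m₂ :* c :+ c)))) refl

lemma10 : (n₁ n₂ n₃ : ℕ) → 2 ≤ n₁ → 2 ≤ n₂ → 2 ≤ n₃ →
    (x₁ y₁ : Fin n₁) (x₂ y₂ : Fin n₂) (z₀ z₁ : Fin n₃) →
    toℕ z₀ ≡ 0 → suc (toℕ z₁) ≡ n₃ →
    n₃ * (n₁ + n₂ ∸ 2) ≤ resolvingInF (x₁ , x₂ , z₀) (y₁ , y₂ , z₁)
lemma10 (suc (suc m₁)) (suc (suc m₂)) (suc (suc m₃)) (s≤s (s≤s z≤n)) (s≤s (s≤s z≤n)) (s≤s (s≤s z≤n))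
        x₁ y₁ x₂ y₂ z₀ z₁ bottom top = begin
  suc c * (m₁ + suc (suc m₂))
    ≤⟨ boundary-count-bound m₁ m₂ m₃ ⟩
  c + (m₂ * c + c) + (m₁ * (c + (m₂ * 0 + c)) + (c + (m₂ * c + c)))
    ≤⟨ sum-allFin-≥-ends row boundaryRow innerRow ⟩
  sum (map row (allFin (suc (suc m₁))))
    ≡⟨ sym resolvingInF≡sum-columns ⟩
  resolvingInF (x₁ , x₂ , z₀) (y₁ , y₂ , z₁) ∎
  where
  open ≤-Reasoning
  open Columns {x₁ = x₁} {y₁} {x₂} {y₂} {z₀} {z₁} bottom top
  c : ℕ
  c = suc m₃
  row : Fin (suc (suc m₁)) → ℕ
  row i = sum (map (column i) (allFin (suc (suc m₂))))
  boundaryRow : ∀ i → Extreme (suc (suc m₁)) i → c + (m₂ * c + c) ≤ row i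
  boundaryRow i i-extreme = sum-allFin-≥-ends (column i)
    (λ j _ → boundary-column-≥ i j (inj₁ i-extreme)) (λ j → boundary-column-≥ i j (inj₁ i-extreme))
  innerRow : ∀ i → c + (m₂ * 0 + c) ≤ row i
  innerRow i = sum-allFin-≥-ends (column i) (λ j j-extreme → boundary-column-≥ i j (inj₂ j-extreme)) (λ _ → z≤n)
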